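{- Let $\mathcal{P}\in\mathbb{F}_2[q]$ be a polynomial with constant term $1$ such that $\operatorname{ord}(\mathcal{P})\ge4$, and let $\mathcal{P}^\ast$ be defined by $\mathcal{P}\mathcal{P}^\ast=1+q^{\operatorname{ord}(\mathcal{P})}$. For a polynomial $\mathcal{Q}$ with constant term $1$, let $\delta(\bar{\mathcal{Q}})$ denote the density of the set of $n\ge0$ for which the coefficient of $q^n$ in $1/\mathcal{Q}\in\mathbb{F}_2[[q]]$ equals $1$. Then \[ \min\{\delta(\bar{\mathcal{P}}),\delta(\bar{\mathcal{P}}^\ast)\}\le\frac12, \] where $\delta(\bar{\mathcal{P}}^\ast)$ denotes the density associated with $1/\mathcal{P}^\ast$.
   Context: $\operatorname{ord}(\mathcal{P})$ is the least positive integer $D$ such that $\mathcal{P}$ divides $1+q^D$ in $\mathbb{F}_2[q]$. The density of $B\subseteq\mathbb{N}$ is $\lim_{n\to\infty}|B\cap[0,n]|/(n+1)$ (it exists here since the coefficient sequences are periodic). -}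

module Defs where

open import Data.Bool using (Bool; true; false; _xor_; _∧_; if_then_else_)
open import Data.List using (List; []; _∷_; replicate; _++_; zipWith; foldr; drop)
open import Data.Nat using (ℕ; zero; suc; _+_; _*_; _≤_; _<_)
open import Data.Product using (Σ; ∃; _×_)
open import Relation.Binary.PropositionalEquality using (_≡_)
open import Relation.Nullary using (¬_)

-- Polynomials over F₂ = Bool (xor as +, ∧ as ·), as coefficient lists,
-- lowest degree first (trailing zeros allowed).
Poly : Set
Poly = List Bool

coeff : Poly → ℕ → Bool
coeff []      _       = false
coeff (a ∷ p) zero    = a
coeff (a ∷ p) (suc n) = coeff p n

_≈P_ : Poly → Poly → Set
p ≈P r = ∀ n → coeff p n ≡ coeff r n

_+P_ : Poly → Poly → Poly
[]      +P r       = r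
(a ∷ p) +P []      = a ∷ p
(a ∷ p) +P (b ∷ r) = (a xor b) ∷ (p +P r)

zeroP : ℕ → Poly
zeroP n = replicate n false

_*P_ : Poly → Poly → Poly
[]      *P r = []
(a ∷ p) *P r = (if a then r else []) +P (false ∷ (p *P r))

onePlusQ^ : ℕ → Poly
onePlusQ^ D = (true ∷ []) +P (replicate D false ++ (true ∷ []))

_∣P_ : Poly → Poly → Set
p ∣P r = Σ Poly (λ s → (p *P s) ≈P r)

IsOrd : Poly → ℕ → Set
IsOrd P D = (1 ≤ D) × (P ∣P onePlusQ^ D) × (∀ D′ → 1 ≤ D′ → D′ < D → ¬ (P ∣P onePlusQ^ D′))

-- Coefficients of 1/Q in F₂[[q]] for Q with constant term 1:
-- a₀ = 1, aₙ = Σ_{i=1}^{n} Qᵢ a_{n-i}.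
-- invRev Q n = [aₙ, a_{n-1}, …, a₀].
invRev : Poly → ℕ → List Bool
invRev Q zero    = true ∷ []
invRev Q (suc n) = foldr _xor_ false (zipWith _∧_ (drop 1 Q) prev) ∷ prev
  where prev = invRev Q n

invCoeff : Poly → ℕ → Bool
invCoeff Q n with invRev Q n
... | []    = false
... | a ∷ _ = a

count : Poly → ℕ → ℕ
count Q zero    = if invCoeff Q zero then 1 else 0
count Q (suc n) = (if invCoeff Q (suc n) then 1 else 0) + count Q n

-- δ(Q̄) ≤ 1/2, given that the density (a limit) exists:
-- for every k ≥ 1, eventually count(n)/(n+1) ≤ 1/2 + 1/k.
DensityAtMostHalf : Poly → Set
DensityAtMostHalf Q =
  ∀ k → 1 ≤ k → ∃ λ N → ∀ n → N ≤ n → 2 * k * count Q n ≤ (k + 2) * suc n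

-- Write P · P* = 1 + q^D, so that deg P + deg P* = D.  Then 1/P* = P/(1 + q^D) is the
-- D-periodic sequence whose period is the coefficient string of P, so δ(P̄*) = wt(P)/D,
-- and symmetrically δ(P̄) = wt(P*)/D, where wt counts the nonzero coefficients.  If both
-- weights exceeded D/2, then P and P* together would have at most one vanishing
-- coefficient up to their degrees, and comparing the coefficients of q, q², q³ (and q⁴)
-- in P · P* with those of 1 + q^D rules this out.
module Submission where

open import Defs
open import Algebra.Bundles using (CommutativeRing)
open import Data.Bool using (Bool; true; false; _xor_; _∧_; if_then_else_)
open import Data.Bool.Properties
  using (xor-∧-commutativeRing; xor-assoc; xor-comm; xor-same; xor-identityʳ;
         ∧-comm; ∧-zeroʳ; ∧-identityʳ; ∧-conicalˡ; ∧-conicalʳ; ∧-distribʳ-xor; ¬-not)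
open import Algebra.Properties.CommutativeSemigroup
  (CommutativeRing.+-commutativeSemigroup xor-∧-commutativeRing) using (interchange)
open import Data.Empty using (⊥; ⊥-elim)
open import Data.List using ([]; _∷_; replicate; _++_; zipWith; foldr; drop; length; applyDownFrom)
open import Data.Nat
  using (ℕ; zero; suc; _+_; _*_; _≤_; _<_; z≤n; s≤s; z<s; _≤?_; NonZero; >-nonZero; >-nonZero⁻¹)
open import Data.Nat.DivMod using (_%_; [m+n]%n≡m%n; m<n⇒m%n≡m)
open import Data.Nat.Induction using (<-rec)
open import Data.Nat.Properties
open import Data.Product using (∃; _×_; _,_)
open import Data.Sum using (_⊎_; inj₁; inj₂)
open import Function using (_∘_; case_of_)
open import Relation.Binary.PropositionalEquality
open import Relation.Nullary using (yes; no)

xor≡false⇒≡ : ∀ {x y} → x xor y ≡ false → x ≡ y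
xor≡false⇒≡ {true}  {true}  _  = refl
xor≡false⇒≡ {true}  {false} ()
xor≡false⇒≡ {false} {true}  ()
xor≡false⇒≡ {false} {false} _  = refl

-- Sequences are power series in F₂[[q]]: ⊕ is their sum, ⊛ their product and shift d
-- multiplication by q^d.
Seq : Set
Seq = ℕ → Bool

infixl 6 _⊕_
infixl 7 _⊛_

_⊕_ : Seq → Seq → Seq
(f ⊕ g) n = f n xor g n

_⊛_ : Seq → Seq → Seq
(f ⊛ g) zero    = f 0 ∧ g 0
(f ⊛ g) (suc n) = (f 0 ∧ g (suc n)) xor ((f ∘ suc) ⊛ g) n

one : Seq
one = coeff (true ∷ [])

shift : ℕ → Seq → Seq
shift zero    g n       = g n
shift (suc d) g zero    = false
shift (suc d) g (suc n) = shift d g n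

DegreeAtMost : Seq → ℕ → Set
DegreeAtMost h a = ∀ i → a < i → h i ≡ false

IsDegree : Seq → ℕ → Set
IsDegree h a = h a ≡ true × DegreeAtMost h a

data Split (d : ℕ) : ℕ → Set where
  below : ∀ {n} → n < d → Split d n
  above : ∀ m → Split d (d + m)

split : ∀ d n → Split d n
split zero    n       = above n
split (suc d) zero    = below (s≤s z≤n)
split (suc d) (suc n) with split d n
... | below n<d = below (s≤s n<d)
... | above m   = above m

shift-< : ∀ d g {n} → n < d → shift d g n ≡ false
shift-< (suc d) g {zero}  _         = refl
shift-< (suc d) g {suc n} (s≤s n<d) = shift-< d g n<d

shift-+ : ∀ d g m → shift d g (d + m) ≡ g m
shift-+ zero    g m = refl
shift-+ (suc d) g m = shift-+ d g m

shift-self : ∀ d g → shift d g d ≡ g 0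
shift-self zero    g = refl
shift-self (suc d) g = shift-self d g

shift-one≡true⇒≡ : ∀ d n → shift d one n ≡ true → n ≡ d
shift-one≡true⇒≡ zero    zero    _ = refl
shift-one≡true⇒≡ (suc d) (suc n) e = cong suc (shift-one≡true⇒≡ d n e)

shift-congʳ : ∀ d .{{_ : NonZero d}} {e e′ : Seq} n →
  (∀ {k} → k < n → e k ≡ e′ k) → shift d e n ≡ shift d e′ n
shift-congʳ d {e} {e′} n e≡e′ with split d n
... | below n<d = trans (shift-< d e n<d) (sym (shift-< d e′ n<d))
... | above m   = begin
  shift d e (d + m)   ≡⟨ shift-+ d e m ⟩
  e m                 ≡⟨ e≡e′ (m<n+m m (>-nonZero⁻¹ d)) ⟩
  e′ m                ≡⟨ shift-+ d e′ m ⟨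
  shift d e′ (d + m)  ∎
  where open ≡-Reasoning

shift-recurrence-unique : ∀ d .{{_ : NonZero d}} {r e e′ : Seq} →
  e ≗ r ⊕ shift d e → e′ ≗ r ⊕ shift d e′ → e ≗ e′
shift-recurrence-unique d {r} {e} {e′} e≗ e′≗ = <-rec _ step
  where
  open ≡-Reasoning
  step : ∀ n → (∀ {k} → k < n → e k ≡ e′ k) → e n ≡ e′ n
  step n ih = begin
    e n                    ≡⟨ e≗ n ⟩
    r n xor shift d e n    ≡⟨ cong (r n xor_) (shift-congʳ d n ih) ⟩
    r n xor shift d e′ n   ≡⟨ e′≗ n ⟨
    e′ n                   ∎

⊛-zeroˡ : ∀ f g → (∀ k → f k ≡ false) → ∀ n → (f ⊛ g) n ≡ false
⊛-zeroˡ f g f≡0 zero    = cong (_∧ g 0) (f≡0 0)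
⊛-zeroˡ f g f≡0 (suc n) =
  cong₂ _xor_ (cong (_∧ g (suc n)) (f≡0 0)) (⊛-zeroˡ (f ∘ suc) g (f≡0 ∘ suc) n)

⊛-congˡ : ∀ {f f′} g → f ≗ f′ → f ⊛ g ≗ f′ ⊛ g
⊛-congˡ g f≗f′ zero    = cong (_∧ g 0) (f≗f′ 0)
⊛-congˡ g f≗f′ (suc n) =
  cong₂ _xor_ (cong (_∧ g (suc n)) (f≗f′ 0)) (⊛-congˡ g (f≗f′ ∘ suc) n)

⊛-congʳ : ∀ f {g g′} n → (∀ {k} → k ≤ n → g k ≡ g′ k) → (f ⊛ g) n ≡ (f ⊛ g′) n
⊛-congʳ f zero    g≡g′ = cong (f 0 ∧_) (g≡g′ z≤n)
⊛-congʳ f (suc n) g≡g′ =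
  cong₂ _xor_ (cong (f 0 ∧_) (g≡g′ ≤-refl)) (⊛-congʳ (f ∘ suc) n (g≡g′ ∘ m≤n⇒m≤1+n))

⊛-unsnoc : ∀ f g n → (f ⊛ g) (suc n) ≡ (f ⊛ (g ∘ suc)) n xor (f (suc n) ∧ g 0)
⊛-unsnoc f g zero    = refl
⊛-unsnoc f g (suc n) =
  trans (cong ((f 0 ∧ g (2 + n)) xor_) (⊛-unsnoc (f ∘ suc) g n))
        (sym (xor-assoc (f 0 ∧ g (2 + n)) _ (f (2 + n) ∧ g 0)))

⊛-comm : ∀ f g → f ⊛ g ≗ g ⊛ f
⊛-comm f g zero    = ∧-comm (f 0) (g 0)
⊛-comm f g (suc n) = begin
  head xor ((f ∘ suc) ⊛ g) n   ≡⟨ cong (head xor_) (⊛-comm (f ∘ suc) g n) ⟩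
  head xor (g ⊛ (f ∘ suc)) n   ≡⟨ xor-comm head _ ⟩
  (g ⊛ (f ∘ suc)) n xor head   ≡⟨ cong ((g ⊛ (f ∘ suc)) n xor_) (∧-comm (f 0) (g (suc n))) ⟩
  (g ⊛ (f ∘ suc)) n xor (g (suc n) ∧ f 0)
                               ≡⟨ ⊛-unsnoc g f n ⟨
  (g ⊛ f) (suc n)              ∎
  where
  open ≡-Reasoning
  head = f 0 ∧ g (suc n)

⊛-distribʳ-⊕ : ∀ f g h → (f ⊕ g) ⊛ h ≗ f ⊛ h ⊕ g ⊛ h
⊛-distribʳ-⊕ f g h zero    = ∧-distribʳ-xor (h 0) (f 0) (g 0)
⊛-distribʳ-⊕ f g h (suc n) =
  trans (cong₂ _xor_ (∧-distribʳ-xor (h (suc n)) (f 0) (g 0)) (⊛-distribʳ-⊕ (f ∘ suc) (g ∘ suc) h n))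
        (interchange (f 0 ∧ h (suc n)) (g 0 ∧ h (suc n)) (((f ∘ suc) ⊛ h) n) (((g ∘ suc) ⊛ h) n))

shift-⊛ : ∀ d f g → shift d f ⊛ g ≗ shift d (f ⊛ g)
shift-⊛ zero    f g n       = refl
shift-⊛ (suc d) f g zero    = refl
shift-⊛ (suc d) f g (suc n) = shift-⊛ d f g n

⊛-top : ∀ {f g} a {b} → DegreeAtMost f a → DegreeAtMost g b →
  ∀ {n} → b ≤ n → (f ⊛ g) (a + n) ≡ f a ∧ g n
⊛-top {f} {g} zero f-deg g-deg {zero}  _ = refl
⊛-top {f} {g} zero f-deg g-deg {suc n} _ =
  trans (cong ((f 0 ∧ g (suc n)) xor_) (⊛-zeroˡ (f ∘ suc) g (λ k → f-deg (suc k) (s≤s z≤n)) n))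
        (xor-identityʳ _)
⊛-top {f} {g} (suc a) f-deg g-deg {n} b≤n
  rewrite g-deg (suc (a + n)) (s≤s (≤-trans b≤n (m≤n+m n a))) | ∧-zeroʳ (f 0) =
  ⊛-top a (λ i a<i → f-deg (suc i) (s≤s a<i)) g-deg b≤n

coeff-+P : ∀ p r n → coeff (p +P r) n ≡ coeff p n xor coeff r n
coeff-+P []      r       n       = refl
coeff-+P (a ∷ p) []      n       = sym (xor-identityʳ _)
coeff-+P (a ∷ p) (b ∷ r) zero    = refl
coeff-+P (a ∷ p) (b ∷ r) (suc n) = coeff-+P p r n

coeff-if : ∀ a r n → coeff (if a then r else []) n ≡ a ∧ coeff r n
coeff-if true  r n = refl
coeff-if false r n = refl

coeff-*P : ∀ p r → coeff (p *P r) ≗ coeff p ⊛ coeff r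
coeff-*P []      r n       = sym (⊛-zeroˡ (coeff []) (coeff r) (λ _ → refl) n)
coeff-*P (a ∷ p) r zero    =
  trans (coeff-+P (if a then r else []) (false ∷ (p *P r)) 0) (trans (xor-identityʳ _) (coeff-if a r 0))
coeff-*P (a ∷ p) r (suc n) =
  trans (coeff-+P (if a then r else []) (false ∷ (p *P r)) (suc n))
        (cong₂ _xor_ (coeff-if a r (suc n)) (coeff-*P p r n))

coeff-replicate-false-++ : ∀ d p → coeff (replicate d false ++ p) ≗ shift d (coeff p)
coeff-replicate-false-++ zero    p n       = refl
coeff-replicate-false-++ (suc d) p zero    = refl
coeff-replicate-false-++ (suc d) p (suc n) = coeff-replicate-false-++ d p n

coeff-length : ∀ p {i} → length p ≤ i → coeff p i ≡ false
coeff-length []      _         = refl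
coeff-length (a ∷ p) (s≤s l≤i) = coeff-length p l≤i

coeff-onePlusQ^ : ∀ d → coeff (onePlusQ^ d) ≗ one ⊕ shift d one
coeff-onePlusQ^ d n =
  trans (coeff-+P (true ∷ []) (replicate d false ++ true ∷ []) n)
        (cong (one n xor_) (coeff-replicate-false-++ d (true ∷ []) n))

onePlusQ^-constant : ∀ {d} → 0 < d → coeff (onePlusQ^ d) 0 ≡ true
onePlusQ^-constant (s≤s _) = refl

onePlusQ^-middle : ∀ {d n} → 0 < n → n < d → coeff (onePlusQ^ d) n ≡ false
onePlusQ^-middle {d} {suc n} _ n<d = trans (coeff-onePlusQ^ d (suc n)) (shift-< d one n<d)

onePlusQ^-top : ∀ {d} → 0 < d → coeff (onePlusQ^ d) d ≡ true
onePlusQ^-top {suc d} _ = trans (coeff-onePlusQ^ (suc d) (suc d)) (shift-self (suc d) one)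

onePlusQ^-support : ∀ d n → coeff (onePlusQ^ d) n ≡ true → n ≡ 0 ⊎ n ≡ d
onePlusQ^-support d zero    _ = inj₁ refl
onePlusQ^-support d (suc n) e =
  inj₂ (shift-one≡true⇒≡ d (suc n) (trans (sym (coeff-onePlusQ^ d (suc n))) e))

one-recurrence : ∀ d → one ≗ coeff (onePlusQ^ d) ⊕ shift d one
one-recurrence d n = sym (begin
  coeff (onePlusQ^ d) n xor s            ≡⟨ cong (_xor s) (coeff-onePlusQ^ d n) ⟩
  (one n xor s) xor s                    ≡⟨ xor-assoc (one n) s s ⟩
  one n xor (s xor s)                    ≡⟨ cong (one n xor_) (xor-same s) ⟩
  one n xor false                        ≡⟨ xor-identityʳ (one n) ⟩
  one n                                  ∎)
  where
  open ≡-Reasoning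
  s = shift d one n

invRev≡applyDownFrom : ∀ Q n → invRev Q n ≡ applyDownFrom (invCoeff Q) (suc n)
invRev≡applyDownFrom Q zero    = refl
invRev≡applyDownFrom Q (suc n) = cong (invCoeff Q (suc n) ∷_) (invRev≡applyDownFrom Q n)

foldr-xor-zipWith-∧ : ∀ p g n →
  foldr _xor_ false (zipWith _∧_ p (applyDownFrom g (suc n))) ≡ (coeff p ⊛ g) n
foldr-xor-zipWith-∧ []          g n       = sym (⊛-zeroˡ (coeff []) g (λ _ → refl) n)
foldr-xor-zipWith-∧ (a ∷ [])    g zero    = xor-identityʳ _
foldr-xor-zipWith-∧ (a ∷ b ∷ p) g zero    = xor-identityʳ _
foldr-xor-zipWith-∧ (a ∷ p)     g (suc n) = cong ((a ∧ g (suc n)) xor_) (foldr-xor-zipWith-∧ p g n)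

coeff-drop-1 : ∀ p → coeff (drop 1 p) ≗ coeff p ∘ suc
coeff-drop-1 []      n = refl
coeff-drop-1 (a ∷ p) n = refl

invCoeff-suc : ∀ Q n → invCoeff Q (suc n) ≡ ((coeff Q ∘ suc) ⊛ invCoeff Q) n
invCoeff-suc Q n = begin
  foldr _xor_ false (zipWith _∧_ (drop 1 Q) (invRev Q n))
    ≡⟨ cong (foldr _xor_ false ∘ zipWith _∧_ (drop 1 Q)) (invRev≡applyDownFrom Q n) ⟩
  foldr _xor_ false (zipWith _∧_ (drop 1 Q) (applyDownFrom (invCoeff Q) (suc n)))
    ≡⟨ foldr-xor-zipWith-∧ (drop 1 Q) (invCoeff Q) n ⟩
  (coeff (drop 1 Q) ⊛ invCoeff Q) n
    ≡⟨ ⊛-congˡ (invCoeff Q) (coeff-drop-1 Q) n ⟩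
  ((coeff Q ∘ suc) ⊛ invCoeff Q) n
    ∎
  where open ≡-Reasoning

invCoeff-unique : ∀ Q c → coeff Q ⊛ c ≗ one → invCoeff Q ≗ c
invCoeff-unique Q c Qc≗one = <-rec _ step
  where
  open ≡-Reasoning
  Q₀ : coeff Q 0 ≡ true
  Q₀ = ∧-conicalˡ (coeff Q 0) (c 0) (Qc≗one 0)
  next : ∀ n → c (suc n) ≡ ((coeff Q ∘ suc) ⊛ c) n
  next n = xor≡false⇒≡
    (subst (λ q → (q ∧ c (suc n)) xor ((coeff Q ∘ suc) ⊛ c) n ≡ false) Q₀ (Qc≗one (suc n)))
  step : ∀ n → (∀ {k} → k < n → invCoeff Q k ≡ c k) → invCoeff Q n ≡ c n
  step zero    _  = sym (∧-conicalʳ (coeff Q 0) (c 0) (Qc≗one 0))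
  step (suc n) ih = begin
    invCoeff Q (suc n)                  ≡⟨ invCoeff-suc Q n ⟩
    ((coeff Q ∘ suc) ⊛ invCoeff Q) n    ≡⟨ ⊛-congʳ (coeff Q ∘ suc) n (ih ∘ s≤s) ⟩
    ((coeff Q ∘ suc) ⊛ c) n             ≡⟨ next n ⟨
    c (suc n)                           ∎

Periodic : ℕ → Seq → Set
Periodic d h = ∀ i → h (i + d) ≡ h i

cycle : ∀ d .{{_ : NonZero d}} → Seq → Seq
cycle d g n = g (n % d)

cycle-below : ∀ d .{{_ : NonZero d}} g {n} → n < d → cycle d g n ≡ g n
cycle-below d g n<d = cong g (m<n⇒m%n≡m n<d)

cycle-periodic : ∀ d .{{_ : NonZero d}} g → Periodic d (cycle d g)
cycle-periodic d g m = cong g ([m+n]%n≡m%n m d)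

cycle-unfold : ∀ d .{{_ : NonZero d}} {g a} → DegreeAtMost g a → a < d →
  cycle d g ≗ g ⊕ shift d (cycle d g)
cycle-unfold d {g} g-deg a<d n with split d n
... | below n<d = begin
  cycle d g n                       ≡⟨ cycle-below d g n<d ⟩
  g n                               ≡⟨ xor-identityʳ (g n) ⟨
  g n xor false                     ≡⟨ cong (g n xor_) (shift-< d (cycle d g) n<d) ⟨
  g n xor shift d (cycle d g) n     ∎
  where open ≡-Reasoning
... | above m = begin
  cycle d g (d + m)                  ≡⟨ cong (cycle d g) (+-comm d m) ⟩
  cycle d g (m + d)                  ≡⟨ cycle-periodic d g m ⟩
  cycle d g m                        ≡⟨ shift-+ d (cycle d g) m ⟨
  shift d (cycle d g) (d + m)        ≡⟨⟩
  false xor shift d (cycle d g) (d + m)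
    ≡⟨ cong (_xor shift d (cycle d g) (d + m)) (g-deg (d + m) (<-≤-trans a<d (m≤m+n d m))) ⟨
  g (d + m) xor shift d (cycle d g) (d + m)  ∎
  where open ≡-Reasoning

-- 1/H = G/(1 + q^d) = G + q^d G + q^{2d} G + ⋯, which is the cycle of G as deg G < d.
cycle-inverse : ∀ d .{{_ : NonZero d}} {G H a} → DegreeAtMost G a → a < d →
  G ⊛ H ≗ coeff (onePlusQ^ d) → H ⊛ cycle d G ≗ one
cycle-inverse d {G} {H} G-deg a<d GH n =
  trans (⊛-comm H c n)
        (shift-recurrence-unique d {r = coeff (onePlusQ^ d)} recurrence (one-recurrence d) n)
  where
  c = cycle d G
  recurrence : c ⊛ H ≗ coeff (onePlusQ^ d) ⊕ shift d (c ⊛ H)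
  recurrence n = begin
    (c ⊛ H) n                                    ≡⟨ ⊛-congˡ H (cycle-unfold d G-deg a<d) n ⟩
    ((G ⊕ shift d c) ⊛ H) n                      ≡⟨ ⊛-distribʳ-⊕ G (shift d c) H n ⟩
    (G ⊛ H) n xor (shift d c ⊛ H) n              ≡⟨ cong₂ _xor_ (GH n) (shift-⊛ d c H n) ⟩
    coeff (onePlusQ^ d) n xor shift d (c ⊛ H) n  ∎
    where open ≡-Reasoning

weight : Seq → ℕ → ℕ
weight h zero    = 0
weight h (suc n) = (if h n then 1 else 0) + weight h n

count≡weight : ∀ Q n → count Q n ≡ weight (invCoeff Q) (suc n)
count≡weight Q zero    = sym (+-identityʳ _)
count≡weight Q (suc n) = cong ((if invCoeff Q (suc n) then 1 else 0) +_) (count≡weight Q n)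

weight-cong : ∀ {h h′} n → (∀ {i} → i < n → h i ≡ h′ i) → weight h n ≡ weight h′ n
weight-cong zero    _     = refl
weight-cong (suc n) h≡h′ =
  cong₂ _+_ (cong (if_then 1 else 0) (h≡h′ ≤-refl)) (weight-cong n (h≡h′ ∘ m<n⇒m<1+n))

weight-≤ : ∀ h n → weight h n ≤ n
weight-≤ h zero    = z≤n
weight-≤ h (suc n) with h n
... | true  = s≤s (weight-≤ h n)
... | false = m≤n⇒m≤1+n (weight-≤ h n)

weight-mono : ∀ h {m n} → m ≤ n → weight h m ≤ weight h n
weight-mono h {n = zero}  z≤n   = ≤-refl
weight-mono h {n = suc n} m≤1+n with m≤n⇒m<n∨m≡n m≤1+n
... | inj₁ (s≤s m≤n) = ≤-trans (weight-mono h m≤n) (m≤n+m _ _)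
... | inj₂ refl      = ≤-refl

weight-<-of-zero : ∀ h {i n} → i < n → h i ≡ false → weight h n < n
weight-<-of-zero h {i} {suc n} (s≤s i≤n) hi with m≤n⇒m<n∨m≡n i≤n | h n in hn
... | inj₂ refl | true  = case trans (sym hi) hn of λ ()
... | inj₂ refl | false = s≤s (weight-≤ h n)
... | inj₁ i<n  | true  = s≤s (weight-<-of-zero h i<n hi)
... | inj₁ i<n  | false = m≤n⇒m≤1+n (weight-<-of-zero h i<n hi)

weight-of-two-zeros : ∀ h {i j n} → i < j → j < n → h i ≡ false → h j ≡ false → 2 + weight h n ≤ n
weight-of-two-zeros h {i} {j} {suc n} i<j (s≤s j≤n) hi hj with m≤n⇒m<n∨m≡n j≤n | h n in hn
... | inj₂ refl | true  = case trans (sym hj) hn of λ ()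
... | inj₂ refl | false = s≤s (weight-<-of-zero h i<j hi)
... | inj₁ j<n  | true  = s≤s (weight-of-two-zeros h i<j j<n hi hj)
... | inj₁ j<n  | false = m≤n⇒m≤1+n (weight-of-two-zeros h i<j j<n hi hj)

weight-stable : ∀ {h a} → DegreeAtMost h a → ∀ {n} → a < n → weight h n ≡ weight h (suc a)
weight-stable {h} {a} h-deg {suc n} (s≤s a≤n) with m≤n⇒m<n∨m≡n a≤n
... | inj₂ refl = refl
... | inj₁ a<n rewrite h-deg n a<n = weight-stable h-deg a<n

weight-periodic : ∀ {h} d → Periodic d h → ∀ m → weight h (m + d) ≡ weight h m + weight h d
weight-periodic {h} d periodic zero    = refl
weight-periodic {h} d periodic (suc m) = begin
  (if h (m + d) then 1 else 0) + weight h (m + d)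
    ≡⟨ cong₂ _+_ (cong (if_then 1 else 0) (periodic m)) (weight-periodic d periodic m) ⟩
  (if h m then 1 else 0) + (weight h m + weight h d)
    ≡⟨ +-assoc (if h m then 1 else 0) (weight h m) (weight h d) ⟨
  (if h m then 1 else 0) + weight h m + weight h d
    ∎
  where open ≡-Reasoning

twice-weight-≤ : ∀ {h} d .{{_ : NonZero d}} → Periodic d h →
  2 * weight h d ≤ d → ∀ n → 2 * weight h n ≤ n + d
twice-weight-≤ {h} d periodic light = <-rec _ step
  where
  open ≤-Reasoning
  step : ∀ n → (∀ {k} → k < n → 2 * weight h k ≤ k + d) → 2 * weight h n ≤ n + d
  step n ih with split d n
  ... | below n<d = ≤-trans (*-monoʳ-≤ 2 (weight-mono h (<⇒≤ n<d))) (≤-trans light (m≤n+m d n))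
  ... | above m   = begin
    2 * weight h (d + m)              ≡⟨ cong (λ k → 2 * weight h k) (+-comm d m) ⟩
    2 * weight h (m + d)              ≡⟨ cong (2 *_) (weight-periodic d periodic m) ⟩
    2 * (weight h m + weight h d)     ≡⟨ *-distribˡ-+ 2 (weight h m) (weight h d) ⟩
    2 * weight h m + 2 * weight h d   ≤⟨ +-mono-≤ (ih (m<n+m m (>-nonZero⁻¹ d))) light ⟩
    m + d + d                         ≡⟨ cong (_+ d) (+-comm m d) ⟩
    d + m + d                         ∎

densityAtMostHalf-of-bound : ∀ Q c → (∀ n → 2 * count Q n ≤ suc n + c) → DensityAtMostHalf Q
densityAtMostHalf-of-bound Q c bound k _ = k * c , eventually
  where
  open ≤-Reasoning
  eventually : ∀ n → k * c ≤ n → 2 * k * count Q n ≤ (k + 2) * suc n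
  eventually n kc≤n = begin
    2 * k * count Q n       ≡⟨ cong (_* count Q n) (*-comm 2 k) ⟩
    k * 2 * count Q n       ≡⟨ *-assoc k 2 (count Q n) ⟩
    k * (2 * count Q n)     ≤⟨ *-monoʳ-≤ k (bound n) ⟩
    k * (suc n + c)         ≡⟨ *-distribˡ-+ k (suc n) c ⟩
    k * suc n + k * c       ≤⟨ +-monoʳ-≤ (k * suc n) kc≤2[1+n] ⟩
    k * suc n + 2 * suc n   ≡⟨ *-distribʳ-+ (suc n) k 2 ⟨
    (k + 2) * suc n         ∎
    where
    kc≤2[1+n] : k * c ≤ 2 * suc n
    kc≤2[1+n] = ≤-trans kc≤n (≤-trans (n≤1+n n) (m≤m+n (suc n) (suc n + 0)))

densityAtMostHalf-of-light-cofactor : ∀ {d a} G Q → DegreeAtMost G a → a < d →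
  G ⊛ coeff Q ≗ coeff (onePlusQ^ d) → 2 * weight G (suc a) ≤ d → DensityAtMostHalf Q
densityAtMostHalf-of-light-cofactor {d} {a} G Q G-deg a<d GQ light =
  densityAtMostHalf-of-bound Q d bound
  where
  instance
    d≢0 : NonZero d
    d≢0 = >-nonZero (≤-trans (s≤s z≤n) a<d)
  c = cycle d G
  1/Q≗c : invCoeff Q ≗ c
  1/Q≗c = invCoeff-unique Q c (cycle-inverse d G-deg a<d GQ)
  period-light : 2 * weight c d ≤ d
  period-light = subst (λ w → 2 * w ≤ d) (sym period-weight) light
    where
    period-weight : weight c d ≡ weight G (suc a)
    period-weight = trans (weight-cong d (cycle-below d G)) (weight-stable G-deg a<d)
  open ≤-Reasoning
  bound : ∀ n → 2 * count Q n ≤ suc n + d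
  bound n = begin
    2 * count Q n                     ≡⟨ cong (2 *_) (count≡weight Q n) ⟩
    2 * weight (invCoeff Q) (suc n)   ≡⟨ cong (2 *_) (weight-cong (suc n) (λ {i} _ → 1/Q≗c i)) ⟩
    2 * weight c (suc n)              ≤⟨ twice-weight-≤ d (cycle-periodic d G) period-light (suc n) ⟩
    suc n + d                         ∎

degree-exists : ∀ {h} L → h 0 ≡ true → (∀ i → L ≤ i → h i ≡ false) → ∃ (IsDegree h)
degree-exists zero h₀ vanishes = case trans (sym h₀) (vanishes 0 z≤n) of λ ()
degree-exists {h} (suc L) h₀ vanishes with h L in hL
... | true  = L , hL , vanishes
... | false = degree-exists L h₀ vanishes-from-L
  where
  vanishes-from-L : ∀ i → L ≤ i → h i ≡ false
  vanishes-from-L i L≤i with m≤n⇒m<n∨m≡n L≤i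
  ... | inj₁ L<i = vanishes i L<i
  ... | inj₂ refl = hL

degree-sum : ∀ {f g a b d} → IsDegree f a → IsDegree g b → 0 < d →
  f ⊛ g ≗ coeff (onePlusQ^ d) → a + b ≡ d
degree-sum {f} {g} {a} {b} {d} (fa , f-deg) (gb , g-deg) 0<d fg
  with onePlusQ^-support d (a + b)
         (trans (sym (fg (a + b))) (trans (⊛-top a f-deg g-deg ≤-refl) (cong₂ _∧_ fa gb)))
... | inj₂ a+b≡d = a+b≡d
... | inj₁ a+b≡0 = case true≡false of λ ()
  where
  open ≡-Reasoning
  true≡false : true ≡ false
  true≡false = begin
    true                     ≡⟨ onePlusQ^-top 0<d ⟨
    coeff (onePlusQ^ d) d    ≡⟨ fg d ⟨
    (f ⊛ g) d                ≡⟨ cong (f ⊛ g) (trans (sym (+-assoc a b d)) (cong (_+ d) a+b≡0)) ⟨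
    (f ⊛ g) (a + (b + d))    ≡⟨ ⊛-top a f-deg g-deg (m≤m+n b d) ⟩
    f a ∧ g (b + d)          ≡⟨ cong (f a ∧_) (g-deg (b + d) (m<m+n b 0<d)) ⟩
    f a ∧ false              ≡⟨ ∧-zeroʳ (f a) ⟩
    false                    ∎

3≤-of-heavy : ∀ {d w k} → 4 ≤ d → d < 2 * w → w ≤ k → 3 ≤ k
3≤-of-heavy 4≤d d<2w w≤k = ≰⇒> λ k≤2 → <⇒≱ d<2w (≤-trans (*-monoʳ-≤ 2 (≤-trans w≤k k≤2)) 4≤d)

m<2*x⇒m<2*y⇒m<x+y : ∀ {m x y} → m < 2 * x → m < 2 * y → m < x + y
m<2*x⇒m<2*y⇒m<x+y {m} {x} {y} m<2x m<2y = *-cancelˡ-≤ 2 (begin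
  2 * suc m          ≡⟨ cong (suc m +_) (+-identityʳ (suc m)) ⟩
  suc m + suc m      ≤⟨ +-mono-≤ m<2x m<2y ⟩
  2 * x + 2 * y      ≡⟨ *-distribˡ-+ 2 x y ⟨
  2 * (x + y)        ∎)
  where open ≤-Reasoning

module HeavyFactors
  {d : ℕ} (4≤d : 4 ≤ d) {f g : Seq} {a b : ℕ}
  (f-deg : DegreeAtMost f a) (g-deg : DegreeAtMost g b) (a+b≡d : a + b ≡ d)
  (fg : f ⊛ g ≗ coeff (onePlusQ^ d))
  (f-heavy : d < 2 * weight f (suc a)) (g-heavy : d < 2 * weight g (suc b))
  where

  middle : ∀ {n} → 0 < n → n < d → (f ⊛ g) n ≡ false
  middle 0<n n<d = trans (fg _) (onePlusQ^-middle 0<n n<d)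

  f₀ : f 0 ≡ true
  f₀ = ∧-conicalˡ (f 0) (g 0) (trans (fg 0) (onePlusQ^-constant (≤-trans (s≤s z≤n) 4≤d)))

  g₀ : g 0 ≡ true
  g₀ = ∧-conicalʳ (f 0) (g 0) (trans (fg 0) (onePlusQ^-constant (≤-trans (s≤s z≤n) 4≤d)))

  2≤a : 2 ≤ a
  2≤a = ≤-pred (3≤-of-heavy 4≤d f-heavy (weight-≤ f (suc a)))

  2≤b : 2 ≤ b
  2≤b = ≤-pred (3≤-of-heavy 4≤d g-heavy (weight-≤ g (suc b)))

  -- Between them f and g have at most one vanishing coefficient up to their degrees.
  excess : a + b < weight f (suc a) + weight g (suc b)
  excess = subst (_< _) (sym a+b≡d)
    (m<2*x⇒m<2*y⇒m<x+y {x = weight f (suc a)} {weight g (suc b)} f-heavy g-heavy)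

  no-shared-zero : ∀ {i j} → i ≤ a → f i ≡ false → j ≤ b → g j ≡ false → ⊥
  no-shared-zero i≤a fi j≤b gj = <⇒≱ excess
    (+-mono-≤ (≤-pred (weight-<-of-zero f (s≤s i≤a) fi)) (≤-pred (weight-<-of-zero g (s≤s j≤b) gj)))

  no-two-zeros : ∀ {i j} → i < j → j ≤ a → f i ≡ false → f j ≡ false → ⊥
  no-two-zeros i<j j≤a fi fj = <⇒≱ excess
    (≤-pred (≤-trans (≤-pred (+-mono-≤ (weight-of-two-zeros f i<j (s≤s j≤a) fi fj) (weight-≤ g (suc b))))
                     (≤-reflexive (+-suc a b))))

  f₁≡g₁ : f 1 ≡ g 1
  f₁≡g₁ with middle {1} (s≤s z≤n) (≤-trans (s≤s (s≤s z≤n)) 4≤d)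
  ... | e rewrite f₀ | g₀ | ∧-identityʳ (f 1) = sym (xor≡false⇒≡ e)

  f₁ : f 1 ≡ true
  f₁ = ¬-not λ f₁≡false → no-shared-zero (≤-pred (m≤n⇒m≤1+n 2≤a)) f₁≡false
                                          (≤-pred (m≤n⇒m≤1+n 2≤b)) (trans (sym f₁≡g₁) f₁≡false)

  g₁ : g 1 ≡ true
  g₁ = trans (sym f₁≡g₁) f₁

  module WhenF₂Vanishes (f₂≡false : f 2 ≡ false) where

    3≤a : 3 ≤ a
    3≤a = 3≤-of-heavy 4≤d f-heavy (≤-pred (weight-<-of-zero f (s≤s 2≤a) f₂≡false))

    g-nonzero : ∀ {j} → j ≤ b → g j ≡ true
    g-nonzero j≤b = ¬-not (no-shared-zero 2≤a f₂≡false j≤b)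

    f₃ : f 3 ≡ true
    f₃ = ¬-not (no-two-zeros ≤-refl 3≤a f₂≡false)

    g₃ : g 3 ≡ false
    g₃ with middle {3} (s≤s z≤n) 4≤d
    ... | e rewrite f₀ | f₁ | f₂≡false | f₃ | g₀ | g-nonzero 2≤b = trans (sym (xor-identityʳ (g 3))) e

    b≡2 : b ≡ 2
    b≡2 = ≤-antisym (≮⇒≥ λ 2<b → case trans (sym (g-nonzero 2<b)) g₃ of λ ()) 2≤b

    a≡3 : a ≡ 3
    a≡3 = ≤-antisym (+-cancelʳ-≤ 2 a 3 (≤-pred a+2<6)) 3≤a
      where
      a+2<6 : a + 2 < 6
      a+2<6 = begin-strict
        a + 2                 ≡⟨ cong (a +_) b≡2 ⟨
        a + b                 ≡⟨ a+b≡d ⟩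
        d                     <⟨ g-heavy ⟩
        2 * weight g (suc b)  ≤⟨ *-monoʳ-≤ 2 (weight-≤ g (suc b)) ⟩
        2 * suc b             ≡⟨ cong (λ b → 2 * suc b) b≡2 ⟩
        6                     ∎
        where open ≤-Reasoning

    -- f = 1 + q + q³ and g = 1 + q + q², whose product 1 + q⁴ + q⁵ is not 1 + q⁵.
    absurd : ⊥
    absurd = case trans (sym product₄) (middle {4} (s≤s z≤n) 4<d) of λ ()
      where
      4<d : 4 < d
      4<d = ≤-reflexive (trans (cong₂ _+_ (sym a≡3) (sym b≡2)) a+b≡d)
      product₄ : (f ⊛ g) 4 ≡ true
      product₄ rewrite f₀ | f₁ | f₂≡false | f₃ | f-deg 4 (≤-reflexive (cong suc a≡3))
                     | g₁ | g₃ | g-deg 4 (m≤n⇒m≤1+n (≤-reflexive (cong suc b≡2))) = refl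

  f₂ : f 2 ≡ true
  f₂ = ¬-not WhenF₂Vanishes.absurd

no-two-heavy-factors : ∀ {d f g a b} → 4 ≤ d → DegreeAtMost f a → DegreeAtMost g b → a + b ≡ d →
  f ⊛ g ≗ coeff (onePlusQ^ d) → d < 2 * weight f (suc a) → d < 2 * weight g (suc b) → ⊥
no-two-heavy-factors {f = f} {g} {a} {b} 4≤d f-deg g-deg a+b≡d fg f-heavy g-heavy =
  case trans (sym product₂) (F.middle (s≤s z≤n) (≤-trans (s≤s (s≤s (s≤s z≤n))) 4≤d)) of λ ()
  where
  module F = HeavyFactors 4≤d f-deg g-deg a+b≡d fg f-heavy g-heavy
  module G = HeavyFactors 4≤d g-deg f-deg (trans (+-comm b a) a+b≡d) (λ n → trans (⊛-comm g f n) (fg n))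
                          g-heavy f-heavy
  product₂ : (f ⊛ g) 2 ≡ true
  product₂ rewrite F.f₀ | F.f₁ | F.f₂ | F.g₀ | F.g₁ | G.f₂ = refl

densityAtMostHalf-of-factors : ∀ {d a b} P P⋆ → 4 ≤ d →
  DegreeAtMost (coeff P) a → DegreeAtMost (coeff P⋆) b → a + b ≡ d →
  coeff P ⊛ coeff P⋆ ≗ coeff (onePlusQ^ d) → DensityAtMostHalf P ⊎ DensityAtMostHalf P⋆
densityAtMostHalf-of-factors {a = zero} P P⋆ (s≤s (s≤s _)) f-deg _ _ fg =
  inj₂ (densityAtMostHalf-of-light-cofactor (coeff P) P⋆ f-deg z<s fg
          (≤-trans (*-monoʳ-≤ 2 (weight-≤ (coeff P) 1)) (s≤s (s≤s z≤n))))
densityAtMostHalf-of-factors {a = suc _} {zero} P P⋆ (s≤s (s≤s _)) _ g-deg _ fg =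
  inj₁ (densityAtMostHalf-of-light-cofactor (coeff P⋆) P g-deg z<s (λ n → trans (⊛-comm _ _ n) (fg n))
          (≤-trans (*-monoʳ-≤ 2 (weight-≤ (coeff P⋆) 1)) (s≤s (s≤s z≤n))))
densityAtMostHalf-of-factors {d} {suc a} {suc b} P P⋆ 4≤d f-deg g-deg a+b≡d fg
  with 2 * weight (coeff P⋆) (2 + b) ≤? d | 2 * weight (coeff P) (2 + a) ≤? d
... | yes g-light | _ =
  inj₁ (densityAtMostHalf-of-light-cofactor (coeff P⋆) P g-deg (subst (suc b <_) a+b≡d (m<n+m (suc b) z<s))
          (λ n → trans (⊛-comm _ _ n) (fg n)) g-light)
... | no _ | yes f-light =
  inj₂ (densityAtMostHalf-of-light-cofactor (coeff P) P⋆ f-deg (subst (suc a <_) a+b≡d (m<m+n (suc a) z<s))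
          fg f-light)
... | no g-heavy | no f-heavy =
  ⊥-elim (no-two-heavy-factors 4≤d f-deg g-deg a+b≡d fg (≰⇒> f-heavy) (≰⇒> g-heavy))

proposition4p5 : (P : Poly) (D : ℕ) → coeff P 0 ≡ true → IsOrd P D → 4 ≤ D →
    (Pstar : Poly) → (P *P Pstar) ≈P onePlusQ^ D →
    DensityAtMostHalf P ⊎ DensityAtMostHalf Pstar
proposition4p5 P D P₀ _ 4≤D Pstar P·P⋆≈ =
  from-degrees (degree-exists (length P) P₀ (λ _ → coeff-length P))
               (degree-exists (length Pstar) P⋆₀ (λ _ → coeff-length Pstar))
  where
  0<D : 0 < D
  0<D = ≤-trans (s≤s z≤n) 4≤D
  fg : coeff P ⊛ coeff Pstar ≗ coeff (onePlusQ^ D)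
  fg n = trans (sym (coeff-*P P Pstar n)) (P·P⋆≈ n)
  P⋆₀ : coeff Pstar 0 ≡ true
  P⋆₀ = ∧-conicalʳ (coeff P 0) (coeff Pstar 0) (trans (fg 0) (onePlusQ^-constant 0<D))
  from-degrees : ∃ (IsDegree (coeff P)) → ∃ (IsDegree (coeff Pstar)) →
    DensityAtMostHalf P ⊎ DensityAtMostHalf Pstar
  from-degrees (_ , P-deg@(_ , f-deg)) (_ , P⋆-deg@(_ , g-deg)) =
    densityAtMostHalf-of-factors P Pstar 4≤D f-deg g-deg (degree-sum P-deg P⋆-deg 0<D fg) fg
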